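{- Let $X_1$ and $X_2$ be disjoint sets. For $i\in\{1,2\}$, let $\mathcal{F}_i\subseteq\mathcal{P}(X_i)$ be a saturated $k_i$-Sperner system which contains $\{\emptyset,X_i\}$, and let $H_i\subseteq X_i$ be homogeneous for $\mathcal{F}_i$. Define \[\mathcal{G}:=\{A\cup B: A\in\mathcal{F}_1^{\mathrm{small}},\,B\in\mathcal{F}_2^{\mathrm{small}}\}\cup\{S\cup T: S\in\mathcal{F}_1^{\mathrm{large}},\,T\in\mathcal{F}_2^{\mathrm{large}}\}\subseteq\mathcal{P}(X_1\cup X_2).\] Then $\mathcal{G}$ is a saturated $(k_1+k_2-2)$-Sperner system which contains $\{\emptyset,X_1\cup X_2\}$, and $H_1\cup H_2$ is homogeneous for $\mathcal{G}$.
   Context: $\mathcal{F}\subseteq\mathcal{P}(X)$ is a $k$-Sperner system if it contains no $(k+1)$-chain $A_1\subsetneq\dots\subsetneq A_{k+1}$ with all $A_j\in\mathcal{F}$; it is saturated if additionally $\mathcal{F}\cup\{S\}$ contains a $(k+1)$-chain for every $S\in\mathcal{P}(X)\setminus\mathcal{F}$. A set $A\subseteq X$ is an atom for $\mathcal{F}$ if it is maximal with respect to the property that $S\cap A\in\{\emptyset,A\}$ for all $S\in\mathcal{F}$; an atom with $|A|\ge2$ is homogeneous for $\mathcal{F}$. Given the homogeneous set $H$ of a saturated $k$-Sperner system $\mathcal{F}$, $\mathcal{F}^{\mathrm{large}}=\{S\in\mathcal{F}:H\subseteq S\}$ and $\mathcal{F}^{\mathrm{small}}=\{S\in\mathcal{F}:S\cap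 H=\emptyset\}$. -}

module Defs where

open import Data.Nat using (ℕ; suc; _≤_)
open import Data.Fin using (Fin) renaming (_<_ to _<ᶠ_)
open import Data.Fin.Subset using (Subset; _⊂_; _⊆_; _∩_; ⊥; ∣_∣)
open import Data.Vec using (_++_)
open import Data.Product using (Σ; _×_; ∃)
open import Data.Sum using (_⊎_)
open import Relation.Nullary using (¬_)
open import Relation.Binary.PropositionalEquality using (_≡_)

Family : ℕ → Set₁
Family n = Subset n → Set

HasChain : {n : ℕ} → Family n → ℕ → Set
HasChain {n} F m =
  Σ (Fin m → Subset n) λ c →
    ((i : Fin m) → F (c i)) × ((i j : Fin m) → i <ᶠ j → c i ⊂ c j)

KSperner : {n : ℕ} → ℕ → Family n → Set
KSperner k F = ¬ HasChain F (suc k)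

insert : {n : ℕ} → Family n → Subset n → Family n
insert F S T = F T ⊎ T ≡ S

SaturatedKSperner : {n : ℕ} → ℕ → Family n → Set
SaturatedKSperner {n} k F =
  KSperner k F × ((S : Subset n) → ¬ F S → HasChain (insert F S) (suc k))

Splits : {n : ℕ} → Family n → Subset n → Set
Splits {n} F A = (S : Subset n) → F S → (S ∩ A ≡ ⊥) ⊎ (S ∩ A ≡ A)

Atom : {n : ℕ} → Family n → Subset n → Set
Atom {n} F A = Splits F A × ((B : Subset n) → A ⊆ B → Splits F B → B ≡ A)

Homogeneous : {n : ℕ} → Family n → Subset n → Set
Homogeneous F A = Atom F A × 2 ≤ ∣ A ∣

Large : {n : ℕ} → Family n → Subset n → Family n
Large F H S = F S × H ⊆ S

Small : {n : ℕ} → Family n → Subset n → Family n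
Small F H S = F S × S ∩ H ≡ ⊥

-- The family G on X₁ ⊔ X₂ = Fin (n₁ + n₂); a subset of the disjoint union is
-- A ++ B with A ⊆ X₁, B ⊆ X₂ (so A ∪ B is rendered A ++ B).
Glue : {n₁ n₂ : ℕ} → Family n₁ → Subset n₁ → Family n₂ → Subset n₂ → Family (n₁ Data.Nat.+ n₂)
Glue {n₁} {n₂} F₁ H₁ F₂ H₂ U =
  (∃ λ (A : Subset n₁) → ∃ λ (B : Subset n₂) →
      Small F₁ H₁ A × Small F₂ H₂ B × U ≡ A ++ B)
  ⊎
  (∃ λ (S : Subset n₁) → ∃ λ (T : Subset n₂) →
      Large F₁ H₁ S × Large F₂ H₂ T × U ≡ S ++ T)

-- A chain in G projects to chains in F₁ and F₂. Each step of the chain is strict in at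
-- least one coordinate, and the step from a small to a large member is strict in both,
-- since it gains a point of H₁ and a point of H₂; padding by ⊥ or ⊤ where the chain has
-- no such step, m members of G yield chains in F₁ and F₂ with at least m + 2 members in
-- total, so m ≤ k₁ + k₂ − 2.
-- For saturation, let C ++ D ∉ G and h ∈ H₁. The set M = (C ∖ H₁) ∪ {h} meets H₁ but
-- misses another point of H₁, so M ∉ F₁, and saturation puts M on a (k₁ + 1)-chain of
-- F₁ ∪ {M}: the members below M are small subsets of C, those above are large supersets
-- of C. Doing the same for D and interleaving the small chains, and the large chains, as
-- staircases gives a chain of k₁ + k₂ − 1 members of G ∪ {C ++ D}.
-- H₁ ++ H₂ is an atom of G because every member of F₁ becomes a member of G after
-- appending ⊥ or ⊤, so a set B₁ ++ B₂ not cut by G has B₁ not cut by F₁ (and likewise B₂).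

module Submission where

open import Defs
open import Data.Nat using (ℕ; zero; suc; _+_; _∸_; _≤_; _<_; _≤?_; z≤n; s≤s)
open import Data.Nat.Properties using (≤-refl; ≤-trans; ≤-reflexive; +-suc; suc-injective; +-mono-≤; +-monoʳ-≤; ∸-monoˡ-≤; n≤1+n; <-irrefl; ≰⇒>)
open import Data.Bool as Bool using (true; false; _∧_)
open import Data.Fin using (Fin; _↑ˡ_; _↑ʳ_; inject≤) renaming (_<_ to _<ᶠ_)
open import Data.Fin.Properties using (toℕ-inject≤)
open import Data.Fin.Subset
open import Data.Fin.Subset.Properties
open import Data.Vec using ([]; _∷_; _++_; here; there; splitAt)
open import Data.Vec.Properties using (zipWith-++; ++-injective; ≡-dec)
open import Data.List as List using (List; []; _∷_; length)
open import Data.List.Membership.Propositional.Properties using (∈-lookup)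
open import Data.List.Relation.Unary.All as All using (All; []; _∷_)
open import Data.List.Relation.Unary.AllPairs using (AllPairs; []; _∷_)
open import Data.List.Relation.Unary.AllPairs.Properties using (tabulate⁺-<)
import Data.List.Relation.Unary.All.Properties as All
open import Data.List.Relation.Unary.Linked as Linked using (Linked; []; [-]; _∷_)
open import Data.List.Relation.Unary.Linked.Properties using (AllPairs⇒Linked; Linked⇒AllPairs; Linked⇒All; map⁺)
open import Data.List.Properties using (length-tabulate; length-++; length-map)
open import Data.List.Relation.Unary.Any as Any using (Any; here; there)
open import Data.List.Membership.Propositional.Properties using (∈-∃++)
open import Data.Product using (∃; ∃₂; _×_; _,_; proj₁; proj₂)
open import Data.Sum as Sum using (_⊎_; inj₁; inj₂)
open import Data.Empty using () renaming (⊥-elim to ⊥₀-elim)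
open import Relation.Nullary using (¬_; yes; no; contradiction)
open import Function using (_∘_)
open import Relation.Binary.PropositionalEquality
open import Data.Nat.Tactic.RingSolver using (solve-∀)

private
  variable
    n n₁ n₂ : ℕ
    x : Fin n
    p q : Subset n

-- Subsets of a disjoint union

∈-++⁺ˡ : {A : Subset n₁} {B : Subset n₂} {x : Fin n₁} → x ∈ A → x ↑ˡ n₂ ∈ A ++ B
∈-++⁺ˡ here      = here
∈-++⁺ˡ (there p) = there (∈-++⁺ˡ p)

∈-++⁻ˡ : {A : Subset n₁} {B : Subset n₂} {x : Fin n₁} → x ↑ˡ n₂ ∈ A ++ B → x ∈ A
∈-++⁻ˡ {A = _ ∷ _} {x = Fin.zero}  here      = here
∈-++⁻ˡ {A = _ ∷ _} {x = Fin.suc x} (there p) = there (∈-++⁻ˡ p)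

∈-++⁺ʳ : (A : Subset n₁) {B : Subset n₂} {x : Fin n₂} → x ∈ B → n₁ ↑ʳ x ∈ A ++ B
∈-++⁺ʳ []      p = p
∈-++⁺ʳ (_ ∷ A) p = there (∈-++⁺ʳ A p)

∈-++⁻ʳ : (A : Subset n₁) {B : Subset n₂} {x : Fin n₂} → n₁ ↑ʳ x ∈ A ++ B → x ∈ B
∈-++⁻ʳ []      p         = p
∈-++⁻ʳ (_ ∷ A) (there p) = ∈-++⁻ʳ A p

++-mono-⊆ : {A A′ : Subset n₁} {B B′ : Subset n₂} → A ⊆ A′ → B ⊆ B′ → A ++ B ⊆ A′ ++ B′
++-mono-⊆ {A = []}    {[]}     A⊆A′ B⊆B′ x∈ = B⊆B′ x∈
++-mono-⊆ {A = _ ∷ _} {_ ∷ _} A⊆A′ B⊆B′ {Fin.zero} here with A⊆A′ here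
... | here = here
++-mono-⊆ {A = _ ∷ _} {_ ∷ _} A⊆A′ B⊆B′ {Fin.suc _} (there x∈) =
  there (++-mono-⊆ (drop-∷-⊆ A⊆A′) B⊆B′ x∈)

++-⊆⁻ˡ : {A A′ : Subset n₁} {B B′ : Subset n₂} → A ++ B ⊆ A′ ++ B′ → A ⊆ A′
++-⊆⁻ˡ A++B⊆ x∈A = ∈-++⁻ˡ (A++B⊆ (∈-++⁺ˡ x∈A))

++-⊆⁻ʳ : (A A′ : Subset n₁) {B B′ : Subset n₂} → A ++ B ⊆ A′ ++ B′ → B ⊆ B′
++-⊆⁻ʳ A A′ A++B⊆ x∈B = ∈-++⁻ʳ A′ (A++B⊆ (∈-++⁺ʳ A x∈B))

++-monoˡ-⊂ : {A A′ : Subset n₁} (B : Subset n₂) → A ⊂ A′ → A ++ B ⊂ A′ ++ B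
++-monoˡ-⊂ B (A⊆A′ , x , x∈A′ , x∉A) =
  ++-mono-⊆ A⊆A′ ⊆-refl , x ↑ˡ _ , ∈-++⁺ˡ x∈A′ , λ x∈ → x∉A (∈-++⁻ˡ {B = B} x∈)

++-monoʳ-⊂ : (A : Subset n₁) {B B′ : Subset n₂} → B ⊂ B′ → A ++ B ⊂ A ++ B′
++-monoʳ-⊂ A (B⊆B′ , x , x∈B′ , x∉B) =
  ++-mono-⊆ ⊆-refl B⊆B′ , _ ↑ʳ x , ∈-++⁺ʳ A x∈B′ , λ x∈ → x∉B (∈-++⁻ʳ A x∈)

++-∩ : (A A′ : Subset n₁) (B B′ : Subset n₂) → (A ++ B) ∩ (A′ ++ B′) ≡ (A ∩ A′) ++ (B ∩ B′)
++-∩ A A′ B B′ = zipWith-++ _∧_ A B A′ B′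

⊥++⊥ : ⊥ {n₁} ++ ⊥ {n₂} ≡ ⊥
⊥++⊥ {zero}   = refl
⊥++⊥ {suc n₁} = cong (false ∷_) (⊥++⊥ {n₁})

⊤++⊤ : ⊤ {n₁} ++ ⊤ {n₂} ≡ ⊤
⊤++⊤ {zero}   = refl
⊤++⊤ {suc n₁} = cong (true ∷_) (⊤++⊤ {n₁})

∣p∣≤∣p++q∣ : (A : Subset n₁) (B : Subset n₂) → ∣ A ∣ ≤ ∣ A ++ B ∣
∣p∣≤∣p++q∣ []          B = z≤n
∣p∣≤∣p++q∣ (true  ∷ A) B = s≤s (∣p∣≤∣p++q∣ A B)
∣p∣≤∣p++q∣ (false ∷ A) B = ∣p∣≤∣p++q∣ A B

++-∩-⊥⊎≡⁻ : (A A′ : Subset n₁) (B B′ : Subset n₂) →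
  (A ++ B) ∩ (A′ ++ B′) ≡ ⊥ ⊎ (A ++ B) ∩ (A′ ++ B′) ≡ A′ ++ B′ →
  (A ∩ A′ ≡ ⊥ × B ∩ B′ ≡ ⊥) ⊎ (A ∩ A′ ≡ A′ × B ∩ B′ ≡ B′)
++-∩-⊥⊎≡⁻ {n₁} {n₂} A A′ B B′ (inj₁ eq) =
  inj₁ (++-injective (A ∩ A′) ⊥ (trans (sym (++-∩ A A′ B B′)) (trans eq (sym (⊥++⊥ {n₁} {n₂})))))
++-∩-⊥⊎≡⁻ A A′ B B′ (inj₂ eq) =
  inj₂ (++-injective (A ∩ A′) A′ (trans (sym (++-∩ A A′ B B′)) eq))

p∩q≡⊥∧x∈p⇒x∉q : p ∩ q ≡ ⊥ → x ∈ p → x ∉ q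
p∩q≡⊥∧x∈p⇒x∉q p∩q≡⊥ x∈p x∈q = ∉⊥ (subst (_ ∈_) p∩q≡⊥ (x∈p∩q⁺ (x∈p , x∈q)))

p∩q≡q⇒q⊆p : p ∩ q ≡ q → q ⊆ p
p∩q≡q⇒q⊆p {p = p} {q} eq x∈q = proj₁ (x∈p∩q⁻ p q (subst (_ ∈_) (sym eq) x∈q))

q⊆p⇒p∩q≡q : q ⊆ p → p ∩ q ≡ q
q⊆p⇒p∩q≡q {q = q} {p = p} q⊆p = ⊆-antisym (p∩q⊆q p q) (λ x∈q → x∈p∩q⁺ (q⊆p x∈q , x∈q))

⊆∧≢⇒⊂ : p ⊆ q → p ≢ q → p ⊂ q
⊆∧≢⇒⊂ {p = p} {q} p⊆q p≢q with p ⊂? q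
... | yes p⊂q = p⊂q
... | no  p⊄q = contradiction (⊆-antisym p⊆q q⊆p) p≢q
  where
  q⊆p : q ⊆ p
  q⊆p {x} x∈q with x ∈? p
  ... | yes x∈p = x∈p
  ... | no  x∉p = contradiction ((λ {y} → p⊆q {y}) , x , x∈q , x∉p) p⊄q

2≤∣p∣⇒∃-distinct : (H : Subset n) → 2 ≤ ∣ H ∣ → ∃₂ λ h h′ → h ∈ H × h′ ∈ H × h′ ≢ h
2≤∣p∣⇒∃-distinct {n} H 2≤∣H∣ with nonempty? H
... | no  ∄h =
  contradiction (≤-trans 2≤∣H∣ (≤-reflexive (trans (cong ∣_∣ (Empty-unique ∄h)) (∣⊥∣≡0 n)))) λ ()
... | yes (h , h∈H) with nonempty? (H ∩ ∁ ⁅ h ⁆)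
...   | yes (h′ , h′∈) = h , h′ , h∈H , proj₁ (x∈p∩q⁻ H _ h′∈) ,
                          x∉⁅y⁆⇒x≢y (x∈∁p⇒x∉p (proj₂ (x∈p∩q⁻ H _ h′∈)))
...   | no  ∄h′ =
  contradiction (≤-trans 2≤∣H∣ (≤-trans (p⊆q⇒∣p∣≤∣q∣ H⊆⁅h⁆) (≤-reflexive (∣⁅x⁆∣≡1 h)))) λ { (s≤s ()) }
  where
  H⊆⁅h⁆ : H ⊆ ⁅ h ⁆
  H⊆⁅h⁆ {x} x∈H with x ∈? ⁅ h ⁆
  ... | yes x∈⁅h⁆ = x∈⁅h⁆
  ... | no  x∉⁅h⁆ = contradiction (x , x∈p∩q⁺ (x∈H , x∉p⇒x∈∁p x∉⁅h⁆)) ∄h′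

-- Chains as lists

Chain : Family n → List (Subset n) → Set
Chain F xs = Linked _⊂_ xs × All F xs

private
  variable
    F : Family n
    xs : List (Subset n)

allPairs-lookup : ∀ {A : Set} {R : A → A → Set} {xs : List A} → AllPairs R xs →
  {i j : Fin (length xs)} → i <ᶠ j → R (List.lookup xs i) (List.lookup xs j)
allPairs-lookup (Rx ∷ _)   {Fin.zero}  {Fin.suc j} _         = All.lookup Rx (∈-lookup j)
allPairs-lookup (_ ∷ Rxs) {Fin.suc i} {Fin.suc j} (s≤s i<j) = allPairs-lookup Rxs i<j

Chain⇒HasChain : Chain F xs → HasChain F (length xs)
Chain⇒HasChain {xs = xs} (linked , Fxs) =
  List.lookup xs , (λ i → All.lookup Fxs (∈-lookup i)) ,
  λ i j → allPairs-lookup (Linked⇒AllPairs ⊂-trans linked)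

HasChain⇒Chain : ∀ {m} → HasChain F m → ∃ λ xs → length xs ≡ m × Chain F xs
HasChain⇒Chain (c , Fc , c↑) =
  List.tabulate c , length-tabulate c ,
  AllPairs⇒Linked (tabulate⁺-< (c↑ _ _)) , All.tabulate⁺ Fc

HasChain-≤ : ∀ {m m′} → m′ ≤ m → HasChain F m → HasChain F m′
HasChain-≤ m′≤m (c , Fc , c↑) =
  (λ i → c (inject≤ i m′≤m)) , (λ i → Fc _) ,
  λ i j i<j → c↑ _ _ (subst₂ _<_ (sym (toℕ-inject≤ i m′≤m)) (sym (toℕ-inject≤ j m′≤m)) i<j)

KSperner⇒length≤ : ∀ {k} → KSperner k F → Chain F xs → length xs ≤ k
KSperner⇒length≤ {F = F} {xs = xs} {k} sperner chain with length xs ≤? k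
... | yes ≤k = ≤k
... | no  ≰k = contradiction (HasChain-≤ {F = F} (≰⇒> ≰k) (Chain⇒HasChain chain)) sperner

Linked-head : ∀ {x} → Linked _⊂_ (x ∷ xs) → All (x ⊂_) xs
Linked-head [-]          = []
Linked-head (x⊂y ∷ rest) = Linked⇒All ⊂-trans x⊂y rest

Linked-++-∷⁻ : ∀ pre {M : Subset n} {post} → Linked _⊂_ (pre List.++ M ∷ post) →
  (Linked _⊂_ pre × All (_⊂ M) pre) × (Linked _⊂_ post × All (M ⊂_) post)
Linked-++-∷⁻ []            linked         = ([] , []) , Linked.tail linked , Linked-head linked
Linked-++-∷⁻ (x ∷ [])      (x⊂M ∷ linked) = ([-] , x⊂M ∷ []) , Linked.tail linked , Linked-head linked
Linked-++-∷⁻ (x ∷ y ∷ pre) (x⊂y ∷ linked) with Linked-++-∷⁻ (y ∷ pre) linked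
... | (pre-linked , y⊂M ∷ pre⊂M) , post = (x⊂y ∷ pre-linked , ⊂-trans x⊂y y⊂M ∷ y⊂M ∷ pre⊂M) , post

Linked-++-∷⁺ : ∀ {pre} {M : Subset n} {post} → Linked _⊂_ pre → All (_⊂ M) pre →
  Linked _⊂_ post → All (M ⊂_) post → Linked _⊂_ (pre List.++ M ∷ post)
Linked-++-∷⁺ []                 _           []          _           = [-]
Linked-++-∷⁺ []                 _           post        (M⊂y ∷ _)   = M⊂y ∷ post
Linked-++-∷⁺ [-]                (x⊂M ∷ _)   post        M⊂post      = x⊂M ∷ Linked-++-∷⁺ [] [] post M⊂post
Linked-++-∷⁺ (x⊂y ∷ pre-linked) (_ ∷ pre⊂M) post        M⊂post      =
  x⊂y ∷ Linked-++-∷⁺ pre-linked pre⊂M post M⊂post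

All⊎Any : ∀ {A : Set} {P Q : A → Set} {xs : List A} → All (λ x → P x ⊎ Q x) xs → All P xs ⊎ Any Q xs
All⊎Any []               = inj₁ []
All⊎Any (inj₂ Qx ∷ _)    = inj₂ (here Qx)
All⊎Any (inj₁ Px ∷ PQxs) = Sum.map (Px ∷_) there (All⊎Any PQxs)

-- Saturated families and homogeneous sets

saturated⇒chain-through : ∀ {k} {M : Subset n} → SaturatedKSperner k F → ¬ F M →
  ∃₂ λ below above → length below + length above ≡ k ×
    Chain (λ x → F x × x ⊂ M) below × Chain (λ x → F x × M ⊂ x) above
saturated⇒chain-through {F = F} {k} {M} (sperner , saturated) M∉F
  with HasChain⇒Chain (saturated M M∉F)
... | xs , length≡ , linked , members with All⊎Any members
...   | inj₁ Fxs = contradiction (subst (HasChain F) length≡ (Chain⇒HasChain (linked , Fxs))) sperner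
...   | inj₂ M∈xs with ∈-∃++ (Any.map sym M∈xs)
...     | below , above , refl with Linked-++-∷⁻ below linked | All.++⁻ below members
...       | (below-linked , below⊂M) , (above-linked , M⊂above) | insert-below , _ ∷ insert-above =
  below , above , length≡′ ,
  (below-linked , All.zipWith below-member (insert-below , below⊂M)) ,
  (above-linked , All.zipWith above-member (insert-above , M⊂above))
  where
  below-member : ∀ {x} → insert F M x × x ⊂ M → F x × x ⊂ M
  below-member (inj₁ Fx , x⊂M)   = Fx , x⊂M
  below-member (inj₂ refl , M⊂M) = contradiction M⊂M (⊂-irref refl)
  above-member : ∀ {x} → insert F M x × M ⊂ x → F x × M ⊂ x
  above-member (inj₁ Fx , M⊂x)   = Fx , M⊂x
  above-member (inj₂ refl , M⊂M) = contradiction M⊂M (⊂-irref refl)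
  length≡′ : length below + length above ≡ k
  length≡′ = suc-injective (begin
    suc (length below + length above) ≡⟨ +-suc (length below) (length above) ⟨
    length below + suc (length above) ≡⟨ length-++ below ⟨
    length (below List.++ M ∷ above)  ≡⟨ length≡ ⟩
    suc k                             ∎)
    where open ≡-Reasoning

Chain-map : ∀ {P Q : Family n} → (∀ {x} → P x → Q x) → Chain P xs → Chain Q xs
Chain-map P⇒Q (linked , Pxs) = linked , All.map P⇒Q Pxs

Chain-pad : ∀ {P : Family n} {d} → P d → Chain P xs →
  ∃₂ λ y ys → Chain P (y ∷ ys) × length xs ≤ suc (length ys)
Chain-pad {xs = []}    Pd _     = _ , [] , ([-] , Pd ∷ []) , z≤n
Chain-pad {xs = _ ∷ _} _  chain = _ , _ , chain , ≤-refl

module _ {H : Subset n} where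

  small⊎large : Splits F H → ∀ {S} → F S → Small F H S ⊎ Large F H S
  small⊎large splits {S} FS = Sum.map (FS ,_) (λ S∩H≡H → FS , p∩q≡q⇒q⊆p S∩H≡H) (splits S FS)

  small⊂large : ∀ {A S} → Nonempty H → A ∩ H ≡ ⊥ → H ⊆ S → A ⊆ S → A ⊂ S
  small⊂large (_ , h∈H) A∩H≡⊥ H⊆S A⊆S = A⊆S , _ , H⊆S h∈H , λ h∈A → p∩q≡⊥∧x∈p⇒x∉q A∩H≡⊥ h∈A h∈H

  large⊈small : ∀ {A S} → Nonempty H → A ∩ H ≡ ⊥ → H ⊆ S → S ⊈ A
  large⊈small (_ , h∈H) A∩H≡⊥ H⊆S S⊆A = p∩q≡⊥∧x∈p⇒x∉q A∩H≡⊥ (S⊆A (H⊆S h∈H)) h∈H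

Below Above : Family n → Subset n → Subset n → Family n
Below F H C x = Small F H x × x ⊆ C
Above F H C x = Large F H x × C ⊆ x

record Tower (k : ℕ) (F : Family n) (H C : Subset n) : Set where
  field
    low   : Subset n
    lows  : List (Subset n)
    below : Chain (Below F H C) (low ∷ lows)
    high  : Subset n
    highs : List (Subset n)
    above : Chain (Above F H C) (high ∷ highs)
    long  : k ≤ suc (length lows) + suc (length highs)

module _ {k} {F : Family n} {H : Subset n} (saturated : SaturatedKSperner k F) (F⊥ : F ⊥) (F⊤ : F ⊤)
         (splits : Splits F H) {h h′} (h∈H : h ∈ H) (h′∈H : h′ ∈ H) (h′≢h : h′ ≢ h) (C : Subset n) where

  private
    M : Subset n
    M = (C ∩ ∁ H) ∪ ⁅ h ⁆

    h∈M : h ∈ M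
    h∈M = x∈p∪q⁺ (inj₂ (x∈⁅x⁆ h))

    h′∉M : h′ ∉ M
    h′∉M h′∈M with x∈p∪q⁻ (C ∩ ∁ H) ⁅ h ⁆ h′∈M
    ... | inj₁ h′∈C∖H = x∈∁p⇒x∉p (proj₂ (x∈p∩q⁻ C (∁ H) h′∈C∖H)) h′∈H
    ... | inj₂ h′∈⁅h⁆ = h′≢h (x∈⁅y⁆⇒x≡y h h′∈⁅h⁆)

    M∉F : ¬ F M
    M∉F FM with splits M FM
    ... | inj₁ M∩H≡⊥ = p∩q≡⊥∧x∈p⇒x∉q M∩H≡⊥ h∈M h∈H
    ... | inj₂ M∩H≡H = h′∉M (p∩q≡q⇒q⊆p M∩H≡H h′∈H)

    below-small : ∀ {x} → F x × x ⊂ M → Below F H C x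
    below-small {x} (Fx , (x⊆M , _)) with splits x Fx
    ... | inj₂ x∩H≡H = contradiction (x⊆M (p∩q≡q⇒q⊆p x∩H≡H h′∈H)) h′∉M
    ... | inj₁ x∩H≡⊥ = (Fx , x∩H≡⊥) , x⊆C
      where
      x⊆C : x ⊆ C
      x⊆C {y} y∈x with x∈p∪q⁻ (C ∩ ∁ H) ⁅ h ⁆ (x⊆M y∈x)
      ... | inj₁ y∈C∖H = proj₁ (x∈p∩q⁻ C (∁ H) y∈C∖H)
      ... | inj₂ y∈⁅h⁆ = contradiction (subst (_∈ x) (x∈⁅y⁆⇒x≡y h y∈⁅h⁆) y∈x) (λ h∈x → p∩q≡⊥∧x∈p⇒x∉q x∩H≡⊥ h∈x h∈H)

    above-large : ∀ {x} → F x × M ⊂ x → Above F H C x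
    above-large {x} (Fx , (M⊆x , _)) with splits x Fx
    ... | inj₁ x∩H≡⊥ = contradiction h∈H (p∩q≡⊥∧x∈p⇒x∉q x∩H≡⊥ (M⊆x h∈M))
    ... | inj₂ x∩H≡H = (Fx , H⊆x) , C⊆x
      where
      H⊆x : H ⊆ x
      H⊆x = p∩q≡q⇒q⊆p x∩H≡H
      C⊆x : C ⊆ x
      C⊆x {y} y∈C with y ∈? H
      ... | yes y∈H = H⊆x y∈H
      ... | no  y∉H = M⊆x (x∈p∪q⁺ (inj₁ (x∈p∩q⁺ (y∈C , x∉p⇒x∈∁p y∉H))))

  tower-through : Tower k F H C
  tower-through with saturated⇒chain-through saturated M∉F
  ... | below , above , length≡ , below-chain , above-chain
    with Chain-pad {P = Below F H C} ((F⊥ , ∩-zeroˡ H) , ⊥⊆) (Chain-map below-small below-chain)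
       | Chain-pad {P = Above F H C} ((F⊤ , ⊆⊤) , ⊆⊤) (Chain-map above-large above-chain)
  ... | low , lows , lower , below≤ | high , highs , upper , above≤ = record
    { below = lower ; above = upper ; long = subst (_≤ _) length≡ (+-mono-≤ below≤ above≤) }

tower : ∀ {k} {H : Subset n} → SaturatedKSperner k F → F ⊥ → F ⊤ → Homogeneous F H →
  (C : Subset n) → Tower k F H C
tower {H = H} saturated F⊥ F⊤ ((splits , _) , 2≤∣H∣) C with 2≤∣p∣⇒∃-distinct H 2≤∣H∣
... | _ , _ , h∈H , h′∈H , h′≢h = tower-through saturated F⊥ F⊤ splits h∈H h′∈H h′≢h C

-- Chains in products

_⊗_ : Family n₁ → Family n₂ → Family (n₁ + n₂)
(P ⊗ Q) U = ∃₂ λ A B → P A × Q B × U ≡ A ++ B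

stair : Subset n₁ → List (Subset n₁) → Subset n₂ → List (Subset n₂) → List (Subset (n₁ + n₂))
stair x []        y ys = List.map (x ++_) (y ∷ ys)
stair x (x′ ∷ xs) y ys = (x ++ y) ∷ stair x′ xs y ys

length-stair : ∀ (x : Subset n₁) xs (y : Subset n₂) ys →
  length (stair x xs y ys) ≡ suc (length xs + length ys)
length-stair x []        y ys = cong suc (length-map (x ++_) ys)
length-stair x (x′ ∷ xs) y ys = cong suc (length-stair x′ xs y ys)

stair-linked : ∀ {x : Subset n₁} {xs} {y : Subset n₂} {ys} →
  Linked _⊂_ (x ∷ xs) → Linked _⊂_ (y ∷ ys) → Linked _⊂_ (stair x xs y ys)
stair-linked {x = x} [-]          ys↑ = map⁺ (Linked.map (++-monoʳ-⊂ x) ys↑)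
stair-linked (x⊂x′ ∷ [-])         ys↑ = ++-monoˡ-⊂ _ x⊂x′ ∷ stair-linked [-] ys↑
stair-linked (x⊂x′ ∷ xs↑@(_ ∷ _)) ys↑ = ++-monoˡ-⊂ _ x⊂x′ ∷ stair-linked xs↑ ys↑

stair-all : ∀ {P : Family n₁} {Q : Family n₂} {x xs y ys} →
  All P (x ∷ xs) → All Q (y ∷ ys) → All (P ⊗ Q) (stair x xs y ys)
stair-all {xs = []}    (Px ∷ [])  Qys          = All.map⁺ (All.map (λ Qy → _ , _ , Px , Qy , refl) Qys)
stair-all {xs = _ ∷ _} (Px ∷ Pxs) Qys@(Qy ∷ _) = (_ , _ , Px , Qy , refl) ∷ stair-all Pxs Qys

stair-chain : ∀ {P : Family n₁} {Q : Family n₂} {x xs y ys} →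
  Chain P (x ∷ xs) → Chain Q (y ∷ ys) → Chain (P ⊗ Q) (stair x xs y ys)
stair-chain (xs↑ , Pxs) (ys↑ , Qys) = stair-linked xs↑ ys↑ , stair-all Pxs Qys

Chain-∷-⊆ : ∀ {A A′ : Subset n} → A ⊆ A′ → F A → Chain F (A′ ∷ xs) → A ≡ A′ ⊎ Chain F (A ∷ A′ ∷ xs)
Chain-∷-⊆ {A = A} {A′} A⊆A′ FA (linked , members) with ≡-dec Bool._≟_ A A′
... | yes A≡A′ = inj₁ A≡A′
... | no  A≢A′ = inj₂ (⊆∧≢⇒⊂ A⊆A′ A≢A′ ∷ linked , FA ∷ members)

record Bichain (F₁ : Family n₁) (F₂ : Family n₂) (A : Subset n₁) (B : Subset n₂) (m : ℕ) : Set where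
  constructor bichain
  field
    rest₁  : List (Subset n₁)
    chain₁ : Chain F₁ (A ∷ rest₁)
    rest₂  : List (Subset n₂)
    chain₂ : Chain F₂ (B ∷ rest₂)
    long   : m ≤ length rest₁ + length rest₂

module _ {F₁ : Family n₁} {F₂ : Family n₂} where

  Bichain-[] : ∀ {A B} → F₁ A → F₂ B → Bichain F₁ F₂ A B 0
  Bichain-[] FA FB = bichain [] ([-] , FA ∷ []) [] ([-] , FB ∷ []) z≤n

  Bichain-≤ : ∀ {A B m m′} → m′ ≤ m → Bichain F₁ F₂ A B m → Bichain F₁ F₂ A B m′
  Bichain-≤ m′≤m (bichain r₁ c₁ r₂ c₂ long) = bichain r₁ c₁ r₂ c₂ (≤-trans m′≤m long)

  Bichain-∷ : ∀ {A A′ B B′ m} → A ++ B ⊂ A′ ++ B′ → F₁ A → F₂ B →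
    Bichain F₁ F₂ A′ B′ m → Bichain F₁ F₂ A B (suc m)
  Bichain-∷ {A = A} {A′} {B} {B′} A++B⊂@(A++B⊆ , _) FA FB (bichain r₁ c₁ r₂ c₂ long)
    with Chain-∷-⊆ (++-⊆⁻ˡ A++B⊆) FA c₁ | Chain-∷-⊆ (++-⊆⁻ʳ A A′ A++B⊆) FB c₂
  ... | inj₁ refl | inj₁ refl = contradiction A++B⊂ (⊂-irref refl)
  ... | inj₁ refl | inj₂ c₂′  = bichain r₁ c₁ (B′ ∷ r₂) c₂′ (≤-trans (s≤s long) (≤-reflexive (sym (+-suc _ _))))
  ... | inj₂ c₁′  | inj₁ refl = bichain (A′ ∷ r₁) c₁′ r₂ c₂ (s≤s long)
  ... | inj₂ c₁′  | inj₂ c₂′  = bichain (A′ ∷ r₁) c₁′ (B′ ∷ r₂) c₂′ (s≤s (≤-trans long (+-monoʳ-≤ _ (n≤1+n _))))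

  Bichain-∷₂ : ∀ {A A′ B B′ m} → A ⊂ A′ → B ⊂ B′ → F₁ A → F₂ B →
    Bichain F₁ F₂ A′ B′ m → Bichain F₁ F₂ A B (2 + m)
  Bichain-∷₂ A⊂A′ B⊂B′ FA FB (bichain r₁ (l₁ , m₁) r₂ (l₂ , m₂) long) =
    bichain (_ ∷ r₁) (A⊂A′ ∷ l₁ , FA ∷ m₁) (_ ∷ r₂) (B⊂B′ ∷ l₂ , FB ∷ m₂)
      (s≤s (≤-trans (s≤s long) (≤-reflexive (sym (+-suc _ _)))))

  Bichain-bound : ∀ {k₁ k₂ A B m} → KSperner k₁ F₁ → KSperner k₂ F₂ →
    Bichain F₁ F₂ A B m → m ≤ k₁ + k₂ ∸ 2
  Bichain-bound sperner₁ sperner₂ (bichain r₁ c₁ r₂ c₂ long) =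
    ≤-trans long (+-pred-mono (KSperner⇒length≤ sperner₁ c₁) (KSperner⇒length≤ sperner₂ c₂))
    where
    +-pred-mono : ∀ {a b c d} → suc a ≤ b → suc c ≤ d → a + c ≤ b + d ∸ 2
    +-pred-mono {a} {b} {c} {d} sa≤b sc≤d =
      subst (_≤ b + d ∸ 2) (cong (_∸ 1) (+-suc a c)) (∸-monoˡ-≤ 2 (+-mono-≤ sa≤b sc≤d))

Homogeneous⇒Nonempty : ∀ {H : Subset n} → Homogeneous F H → Nonempty H
Homogeneous⇒Nonempty {H = H} (_ , 2≤∣H∣) with 2≤∣p∣⇒∃-distinct H 2≤∣H∣
... | h , _ , h∈H , _ = h , h∈H

glued-length : ∀ {k₁ k₂} a b c d → k₁ ≤ suc a + suc b → k₂ ≤ suc c + suc d →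
  suc (k₁ + k₂ ∸ 2) ≤ suc (a + c) + suc (suc (b + d))
glued-length a b c d k₁≤ k₂≤ =
  s≤s (≤-trans (∸-monoˡ-≤ 2 (+-mono-≤ k₁≤ k₂≤)) (≤-reflexive (cong (_∸ 2) (regroup a b c d))))
  where
  regroup : ∀ a b c d → (suc a + suc b) + (suc c + suc d) ≡ suc (suc ((a + c) + suc (suc (b + d))))
  regroup = solve-∀

-- The glued family

module Glued {k₁ k₂} {F₁ : Family n₁} {F₂ : Family n₂} {H₁ : Subset n₁} {H₂ : Subset n₂}
  (saturated₁ : SaturatedKSperner k₁ F₁) (F₁⊥ : F₁ ⊥) (F₁⊤ : F₁ ⊤) (homogeneous₁ : Homogeneous F₁ H₁)
  (saturated₂ : SaturatedKSperner k₂ F₂) (F₂⊥ : F₂ ⊥) (F₂⊤ : F₂ ⊤) (homogeneous₂ : Homogeneous F₂ H₂)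
  where

  G : Family (n₁ + n₂)
  G = Glue F₁ H₁ F₂ H₂

  k : ℕ
  k = k₁ + k₂ ∸ 2

  private
    H₁≢∅ : Nonempty H₁
    H₁≢∅ = Homogeneous⇒Nonempty homogeneous₁
    H₂≢∅ : Nonempty H₂
    H₂≢∅ = Homogeneous⇒Nonempty homogeneous₂

  G⊥ : G ⊥
  G⊥ = inj₁ (⊥ , ⊥ , (F₁⊥ , ∩-zeroˡ H₁) , (F₂⊥ , ∩-zeroˡ H₂) , sym (⊥++⊥ {n₁} {n₂}))

  G⊤ : G ⊤
  G⊤ = inj₂ (⊤ , ⊤ , (F₁⊤ , ⊆⊤) , (F₂⊤ , ⊆⊤) , sym (⊤++⊤ {n₁} {n₂}))

  -- A chain starting at a small member still has its small-to-large step (or the step to ⊤)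
  -- ahead, which is strict in both coordinates: hence the extra unit.
  BichainAt : ∀ {U} → G U → ℕ → Set
  BichainAt (inj₁ (A , B , _)) m = Bichain F₁ F₂ A B (suc m)
  BichainAt (inj₂ (S , T , _)) m = Bichain F₁ F₂ S T m

  G-chain⇒BichainAt : ∀ {U Us} (g : G U) → Linked _⊂_ (U ∷ Us) → All G Us → BichainAt g (length Us)
  G-chain⇒BichainAt (inj₁ (A , B , (FA , A∩H₁≡⊥) , (FB , B∩H₂≡⊥) , refl)) [-] [] =
    Bichain-≤ (n≤1+n 1) (Bichain-∷₂ (small⊂large H₁≢∅ A∩H₁≡⊥ ⊆⊤ ⊆⊤)
                                    (small⊂large H₂≢∅ B∩H₂≡⊥ ⊆⊤ ⊆⊤) FA FB (Bichain-[] F₁⊤ F₂⊤))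
  G-chain⇒BichainAt (inj₂ (S , T , (FS , _) , (FT , _) , refl)) [-] [] = Bichain-[] FS FT
  G-chain⇒BichainAt (inj₁ (A , B , (FA , _) , (FB , _) , refl)) (U⊂U′ ∷ linked)
                    (g′@(inj₁ (_ , _ , _ , _ , refl)) ∷ Gs) =
    Bichain-∷ U⊂U′ FA FB (G-chain⇒BichainAt g′ linked Gs)
  G-chain⇒BichainAt (inj₁ (A , B , (FA , A∩H₁≡⊥) , (FB , B∩H₂≡⊥) , refl)) ((U⊆U′ , _) ∷ linked)
                    (g′@(inj₂ (S , _ , (_ , H₁⊆S) , (_ , H₂⊆T) , refl)) ∷ Gs) =
    Bichain-∷₂ (small⊂large H₁≢∅ A∩H₁≡⊥ H₁⊆S (++-⊆⁻ˡ U⊆U′))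
               (small⊂large H₂≢∅ B∩H₂≡⊥ H₂⊆T (++-⊆⁻ʳ A S U⊆U′)) FA FB (G-chain⇒BichainAt g′ linked Gs)
  G-chain⇒BichainAt (inj₂ (S , _ , (_ , H₁⊆S) , _ , refl)) ((U⊆U′ , _) ∷ _)
                    (inj₁ (_ , _ , (_ , A∩H₁≡⊥) , _ , refl) ∷ _) =
    ⊥₀-elim (large⊈small H₁≢∅ A∩H₁≡⊥ H₁⊆S (++-⊆⁻ˡ U⊆U′))
  G-chain⇒BichainAt (inj₂ (S , T , (FS , _) , (FT , _) , refl)) (U⊂U′ ∷ linked)
                    (g′@(inj₂ (_ , _ , _ , _ , refl)) ∷ Gs) =
    Bichain-∷ U⊂U′ FS FT (G-chain⇒BichainAt g′ linked Gs)

  G-chain⇒Bichain : ∀ {U Us} → Chain G (U ∷ Us) → ∃₂ λ A B → Bichain F₁ F₂ A B (suc (length Us))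
  G-chain⇒Bichain (linked , g@(inj₁ (A , B , _)) ∷ Gs) = A , B , G-chain⇒BichainAt g linked Gs
  G-chain⇒Bichain (linked , g@(inj₂ (S , T , (FS , H₁⊆S) , (FT , H₂⊆T) , _)) ∷ Gs) =
    ⊥ , ⊥ , Bichain-≤ (n≤1+n _) (Bichain-∷₂ (small⊂large H₁≢∅ (∩-zeroˡ H₁) H₁⊆S ⊥⊆)
                                            (small⊂large H₂≢∅ (∩-zeroˡ H₂) H₂⊆T ⊥⊆)
                                            F₁⊥ F₂⊥ (G-chain⇒BichainAt g linked Gs))

  G-sperner : KSperner k G
  G-sperner hasChain with HasChain⇒Chain hasChain
  ... | U ∷ Us , length≡ , chain with G-chain⇒Bichain chain
  ...   | _ , _ , chains =
    <-irrefl refl (subst (λ m → suc m ≤ k) (suc-injective length≡)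
      (Bichain-bound (proj₁ saturated₁) (proj₁ saturated₂) chains))

  G-saturated : (U : Subset (n₁ + n₂)) → ¬ G U → HasChain (insert G U) (suc k)
  G-saturated U U∉G with splitAt n₁ U
  ... | C , D , refl = HasChain-≤ {F = insert G (C ++ D)} long (Chain⇒HasChain (linked , members))
    where
    module T₁ = Tower (tower saturated₁ F₁⊥ F₁⊤ homogeneous₁ C)
    module T₂ = Tower (tower saturated₂ F₂⊥ F₂⊤ homogeneous₂ D)

    lower = stair T₁.low T₁.lows T₂.low T₂.lows
    upper = stair T₁.high T₁.highs T₂.high T₂.highs

    strictly-below : ∀ {u} → (Below F₁ H₁ C ⊗ Below F₂ H₂ D) u → G u × u ⊂ C ++ D
    strictly-below (A , B , (SA , A⊆C) , (SB , B⊆D) , refl) =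
      g , ⊆∧≢⇒⊂ (++-mono-⊆ A⊆C B⊆D) (λ eq → U∉G (subst G eq g))
      where g = inj₁ (A , B , SA , SB , refl)

    strictly-above : ∀ {u} → (Above F₁ H₁ C ⊗ Above F₂ H₂ D) u → G u × C ++ D ⊂ u
    strictly-above (S , T , (LS , C⊆S) , (LT , D⊆T) , refl) =
      g , ⊆∧≢⇒⊂ (++-mono-⊆ C⊆S D⊆T) (λ eq → U∉G (subst G (sym eq) g))
      where g = inj₂ (S , T , LS , LT , refl)

    lower-chain : Chain (λ u → G u × u ⊂ C ++ D) lower
    lower-chain = Chain-map strictly-below (stair-chain T₁.below T₂.below)

    upper-chain : Chain (λ u → G u × C ++ D ⊂ u) upper
    upper-chain = Chain-map strictly-above (stair-chain T₁.above T₂.above)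

    linked : Linked _⊂_ (lower List.++ (C ++ D) ∷ upper)
    linked = Linked-++-∷⁺ (proj₁ lower-chain) (All.map proj₂ (proj₂ lower-chain))
                          (proj₁ upper-chain) (All.map proj₂ (proj₂ upper-chain))

    members : All (insert G (C ++ D)) (lower List.++ (C ++ D) ∷ upper)
    members = All.++⁺ (All.map (inj₁ ∘ proj₁) (proj₂ lower-chain))
                      (inj₂ refl ∷ All.map (inj₁ ∘ proj₁) (proj₂ upper-chain))

    long : suc k ≤ length (lower List.++ (C ++ D) ∷ upper)
    long = subst (suc k ≤_) (sym length≡)
      (glued-length (length T₁.lows) (length T₁.highs) (length T₂.lows) (length T₂.highs) T₁.long T₂.long)
      where
      length≡ : length (lower List.++ (C ++ D) ∷ upper) ≡
                suc (length T₁.lows + length T₂.lows) + suc (suc (length T₁.highs + length T₂.highs))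
      length≡ = trans (length-++ lower)
        (cong₂ (λ l u → l + suc u) (length-stair T₁.low T₁.lows T₂.low T₂.lows)
                                   (length-stair T₁.high T₁.highs T₂.high T₂.highs))

  G-splits : Splits G (H₁ ++ H₂)
  G-splits _ (inj₁ (A , B , (_ , A∩H₁≡⊥) , (_ , B∩H₂≡⊥) , refl)) = inj₁ (begin
    (A ++ B) ∩ (H₁ ++ H₂) ≡⟨ ++-∩ A H₁ B H₂ ⟩
    (A ∩ H₁) ++ (B ∩ H₂)  ≡⟨ cong₂ _++_ A∩H₁≡⊥ B∩H₂≡⊥ ⟩
    ⊥ {n₁} ++ ⊥ {n₂}      ≡⟨ ⊥++⊥ {n₁} {n₂} ⟩
    ⊥                     ∎)
    where open ≡-Reasoning
  G-splits _ (inj₂ (S , T , (_ , H₁⊆S) , (_ , H₂⊆T) , refl)) =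
    inj₂ (trans (++-∩ S H₁ T H₂) (cong₂ _++_ (q⊆p⇒p∩q≡q H₁⊆S) (q⊆p⇒p∩q≡q H₂⊆T)))

  private
    extendʳ : ∀ {S} → F₁ S → ∃ λ T → G (S ++ T)
    extendʳ FS with small⊎large (proj₁ (proj₁ homogeneous₁)) FS
    ... | inj₁ small = ⊥ , inj₁ (_ , _ , small , (F₂⊥ , ∩-zeroˡ H₂) , refl)
    ... | inj₂ large = ⊤ , inj₂ (_ , _ , large , (F₂⊤ , ⊆⊤) , refl)

    extendˡ : ∀ {T} → F₂ T → ∃ λ S → G (S ++ T)
    extendˡ FT with small⊎large (proj₁ (proj₁ homogeneous₂)) FT
    ... | inj₁ small = ⊥ , inj₁ (_ , _ , (F₁⊥ , ∩-zeroˡ H₁) , small , refl)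
    ... | inj₂ large = ⊤ , inj₂ (_ , _ , (F₁⊤ , ⊆⊤) , large , refl)

  Splits-++⁻ˡ : ∀ {B₁ B₂} → Splits G (B₁ ++ B₂) → Splits F₁ B₁
  Splits-++⁻ˡ {B₁} {B₂} splits S FS with extendʳ FS
  ... | T , g = Sum.map proj₁ proj₁ (++-∩-⊥⊎≡⁻ S B₁ T B₂ (splits _ g))

  Splits-++⁻ʳ : ∀ {B₁ B₂} → Splits G (B₁ ++ B₂) → Splits F₂ B₂
  Splits-++⁻ʳ {B₁} {B₂} splits T FT with extendˡ FT
  ... | S , g = Sum.map proj₂ proj₂ (++-∩-⊥⊎≡⁻ S B₁ T B₂ (splits _ g))

  G-homogeneous : Homogeneous G (H₁ ++ H₂)
  G-homogeneous = (G-splits , maximal) , ≤-trans (proj₂ homogeneous₁) (∣p∣≤∣p++q∣ H₁ H₂)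
    where
    maximal : ∀ B → H₁ ++ H₂ ⊆ B → Splits G B → B ≡ H₁ ++ H₂
    maximal B H⊆B splits with splitAt n₁ B
    ... | B₁ , B₂ , refl = cong₂ _++_
      (proj₂ (proj₁ homogeneous₁) B₁ (++-⊆⁻ˡ H⊆B) (Splits-++⁻ˡ splits))
      (proj₂ (proj₁ homogeneous₂) B₂ (++-⊆⁻ʳ H₁ B₁ H⊆B) (Splits-++⁻ʳ splits))

lemma3p1 : (n₁ n₂ k₁ k₂ : ℕ) (F₁ : Family n₁) (F₂ : Family n₂)
    (H₁ : Subset n₁) (H₂ : Subset n₂) →
    SaturatedKSperner k₁ F₁ → F₁ ⊥ → F₁ ⊤ → Homogeneous F₁ H₁ →
    SaturatedKSperner k₂ F₂ → F₂ ⊥ → F₂ ⊤ → Homogeneous F₂ H₂ →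
    SaturatedKSperner (k₁ + k₂ ∸ 2) (Glue F₁ H₁ F₂ H₂)
      × Glue F₁ H₁ F₂ H₂ ⊥ × Glue F₁ H₁ F₂ H₂ ⊤
      × Homogeneous (Glue F₁ H₁ F₂ H₂) (H₁ ++ H₂)
lemma3p1 _ _ _ _ _ _ _ _ saturated₁ F₁⊥ F₁⊤ homogeneous₁ saturated₂ F₂⊥ F₂⊤ homogeneous₂ =
  (G-sperner , G-saturated) , G⊥ , G⊤ , G-homogeneous
  where open Glued saturated₁ F₁⊥ F₁⊤ homogeneous₁ saturated₂ F₂⊥ F₂⊤ homogeneous₂
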